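{- Let $G=(V,E,L)$ be a rigid looped simple graph, and let $(G_1,G_2)$, $(G_1',G_2')$ be two unbalanced $2$-separations of $G$, where $G_i=(V_i,E_i,L_i)$ and $G_i'=(V_i',E_i',L_i')$ for $i=1,2$, $L_2=\emptyset=L_2'$, $V_1\cap V_2=\{u,v\}$, $V_1'\cap V_2'=\{u',v'\}$ and $\{u,v\}\cap\{u',v'\}=\emptyset$. Then $\{u',v'\}\subseteq V_i$ for some $i\in\{1,2\}$.
   Context: A looped simple graph $G=(V,E,L)$: $E$ is a set of non-loop edges with no parallel edges, $L$ a set of loops (several may be at one vertex). $G$ is rigid if its rigidity matrix (rows: for $uv\in E$, $p(u)-p(v)$ in the columns of $u$ and $p(v)-p(u)$ in the columns of $v$; for a loop $\ell$ at $v$, $q(\ell)$ in the columns of $v$; zeros elsewhere) has rank $2|V|$ for some $p:V\to\mathbb{R}^2$, $q:L\to\mathbb{R}^2$. An unbalanced $2$-separation of $G$ is an ordered pair $(G_1,G_2)$ of subgraphs with $G=G_1\cup G_2$, $|V(G_1)\cap V(G_2)|=2<|V(G_2)|$, $E(G_1)\cap E(G_2)=\emptyset$ and $G_2$ has no loops.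
   Formalization: Rigidity is defined with the realisations p and q taking values in ℚ² instead of ℝ², the rank of the rigidity matrix being taken over ℚ. -}

module Defs where

open import Data.Nat using (ℕ)
open import Data.Fin using (Fin)
open import Data.Fin.Subset using (Subset; _∈_)
open import Data.List using (List; length; lookup)
open import Data.Product using (Σ; ∃; _×_; _,_; proj₁; proj₂)
open import Data.Sum using (_⊎_)
open import Data.Bool using (Bool; true; false)
open import Data.Rational using (ℚ; 0ℚ; _+_; _*_; _-_)
open import Relation.Binary.PropositionalEquality using (_≡_; _≢_)
open import Function.Bundles using (_⇔_)

ℚ² : Set
ℚ² = ℚ × ℚ

_−²_ : ℚ² → ℚ² → ℚ²
(a , b) −² (c , d) = (a - c , b - d)

_·_ : ℚ² → ℚ² → ℚ
(a , b) · (c , d) = a * c + b * d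

0² : ℚ²
0² = (0ℚ , 0ℚ)

-- A looped graph on vertex set Fin n: a list of (non-loop) edges, each
-- given by its two end-vertices, and a list of loops, each given by the
-- vertex it is attached to (several loops may sit at one vertex; distinct
-- list positions are distinct loops / edges).
record LoopedGraph (n : ℕ) : Set where
  field
    edges : List (Fin n × Fin n)
    loops : List (Fin n)

  Edge : Set
  Edge = Fin (length edges)

  Loop : Set
  Loop = Fin (length loops)

  end₁ : Edge → Fin n
  end₁ e = proj₁ (lookup edges e)

  end₂ : Edge → Fin n
  end₂ e = proj₂ (lookup edges e)

  loopAt : Loop → Fin n
  loopAt l = lookup loops l

open LoopedGraph public

SameEnds : {n : ℕ} → Fin n × Fin n → Fin n × Fin n → Set
SameEnds (a , b) (c , d) = (a ≡ c × b ≡ d) ⊎ (a ≡ d × b ≡ c)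

IsLoopedSimple : {n : ℕ} → LoopedGraph n → Set
IsLoopedSimple G =
  ((e : Edge G) → end₁ G e ≢ end₂ G e) ×
  ((e f : Edge G) → SameEnds (lookup (edges G) e) (lookup (edges G) f) → e ≡ f)

-- x lies in the kernel of the rigidity matrix R(G,p,q):
-- row of edge uv: (p u − p v)·x u + (p v − p u)·x v = 0,
-- row of loop ℓ at v: q ℓ · x v = 0.
InKernel : {n : ℕ} (G : LoopedGraph n) → (Fin n → ℚ²) → (Loop G → ℚ²) →
           (Fin n → ℚ²) → Set
InKernel G p q x =
  ((e : Edge G) →
     let a = end₁ G e ; b = end₂ G e in
     ((p a −² p b) · x a) + ((p b −² p a) · x b) ≡ 0ℚ) ×
  ((l : Loop G) → q l · x (loopAt G l) ≡ 0ℚ)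

-- Rigid: for some p, q the rigidity matrix has rank 2|V|, i.e. (it has
-- 2|V| columns) its columns are linearly independent: the kernel is trivial.
Rigid : {n : ℕ} → LoopedGraph n → Set
Rigid {n} G =
  Σ (Fin n → ℚ²) λ p → Σ (Loop G → ℚ²) λ q →
    (x : Fin n → ℚ²) → InKernel G p q x → (w : Fin n) → x w ≡ 0²

-- E(G₁), E(G₂) partition E (recorded by `inE₁`), all loops lie in G₁
-- (G₂ has no loops), and each G_i is a subgraph on vertex set V_i.
record Unbalanced2Sep {n : ℕ} (G : LoopedGraph n) (u v : Fin n) : Set where
  field
    V₁ V₂     : Subset n
    inE₁      : Edge G → Bool
    cover     : (w : Fin n) → w ∈ V₁ ⊎ w ∈ V₂
    edges₁    : (e : Edge G) → inE₁ e ≡ true →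
                  end₁ G e ∈ V₁ × end₂ G e ∈ V₁
    edges₂    : (e : Edge G) → inE₁ e ≡ false →
                  end₁ G e ∈ V₂ × end₂ G e ∈ V₂
    loops₁    : (l : Loop G) → loopAt G l ∈ V₁
    u≢v       : u ≢ v
    meet      : (w : Fin n) → (w ∈ V₁ × w ∈ V₂) ⇔ (w ≡ u ⊎ w ≡ v)
    unbalanced : ∃ λ w → w ∈ V₂ × w ≢ u × w ≢ v

open Unbalanced2Sep public

-- Suppose u′ ∈ V₁ ∖ V₂ and v′ ∈ V₂ ∖ V₁. The two separations cut V into the
-- four quadrants Vᵢ ∩ V′ⱼ; distinct quadrants meet only in the hinges u, v, u′, v′,
-- and V₁ ∩ V′₁ carries every loop. An infinitesimal rigid motion chosen on each
-- quadrant, zero on V₁ ∩ V′₁ and consistent at the hinges, glues to a vector in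
-- the kernel of the rigidity matrix, so by rigidity it vanishes.
-- If u and v lie on the same side of (G₁′, G₂′), some quadrants hang from the rest
-- at single points; rotating them about those points shows that they are collapsed
-- to a point, and then a vertex lying only in collapsed quadrants can move alone.
-- Otherwise the three loose quadrants form a four-bar linkage with joints at
-- p u, p v′, p v, p u′, grounded on V₁ ∩ V′₁. A planar four-bar linkage always has
-- a nonzero infinitesimal flex; it is written down for the generic position, for
-- collinear bars, and for each coincidence of joints.

module Submission where

open import Defs
open import Data.Nat using (ℕ)
open import Data.Fin using (Fin)
open import Data.Fin.Subset using (_∈_; _∉_)
open import Data.Product using (_×_; _,_; proj₁; proj₂; ∃)
open import Data.Sum using (_⊎_; inj₁; inj₂; map₂; [_,_]; [_,_]′)
open import Relation.Binary.PropositionalEquality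
  using (_≡_; _≢_; refl; sym; trans; cong; cong₂; subst; ≢-sym; module ≡-Reasoning)

import Data.Sum as Sum
open import Data.Bool using (Bool; true; false; if_then_else_)
open import Data.Empty using (⊥; ⊥-elim)
open import Data.Fin.Properties using () renaming (_≟_ to _≟ᶠ_)
open import Data.Rational using (ℚ; 0ℚ; 1ℚ; _+_; _*_; _-_; -_; 1/_; ≢-nonZero)
open import Data.Rational.Properties
  using (_≟_; +-*-commutativeRing; +-0-group; +-inverseʳ; +-identityˡ; +-identityʳ;
         *-assoc; *-identityˡ; *-identityʳ; *-zeroˡ; *-zeroʳ; *-inverseˡ; neg-injective)
open import Algebra.Properties.Group +-0-group using (x∙y⁻¹≈ε⇒x≈y)
open import Data.Vec.Functional using (updateAt)
open import Data.Vec.Functional.Properties using (updateAt-updates; updateAt-minimal)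
open import Function using (_∘_; id; case_of_)
open import Function.Bundles using (Equivalence; mk⇔)
open import Level using (0ℓ)
open import Relation.Nullary using (¬_; yes; no)
open import Relation.Nullary.Decidable using (dec⇒maybe)
open import Tactic.RingSolver using (solve-∀)
open import Tactic.RingSolver.Core.AlmostCommutativeRing
  using (AlmostCommutativeRing; fromCommutativeRing)

open ≡-Reasoning

-- Infinitesimal motions of the plane

ℚ-ring : AlmostCommutativeRing 0ℓ 0ℓ
ℚ-ring = fromCommutativeRing +-*-commutativeRing (λ x → dec⇒maybe (0ℚ ≟ x))

infixl 6 _+²_
infixl 7 _⊙_

_+²_ : ℚ² → ℚ² → ℚ²
(a , b) +² (c , d) = (a + c , b + d)

_⊙_ : ℚ → ℚ² → ℚ²
s ⊙ (a , b) = (s * a , s * b)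

perp : ℚ² → ℚ²
perp (a , b) = (- b , a)

cross : ℚ² → ℚ² → ℚ
cross (a , b) (c , d) = a * d - b * c

-- Velocity at z of the infinitesimal rotation about c with angular speed s,
-- and of that rotation followed by the translation t.
rotation : ℚ → ℚ² → ℚ² → ℚ²
rotation s c z = s ⊙ perp (z −² c)

motion : ℚ → ℚ² → ℚ² → ℚ² → ℚ²
motion s c t z = rotation s c z +² t

-- The row of the rigidity matrix of a bar PQ applied to velocities x at P and
-- y at Q: half the rate of change of |P − Q|².
elongation : ℚ² → ℚ² → ℚ² → ℚ² → ℚ
elongation P Q x y = ((P −² Q) · x) + ((Q −² P) · y)

r*s≡0⇒r≡0⊎s≡0 : ∀ {r s} → r * s ≡ 0ℚ → r ≡ 0ℚ ⊎ s ≡ 0ℚ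
r*s≡0⇒r≡0⊎s≡0 {r} {s} rs≡0 with r ≟ 0ℚ
... | yes r≡0 = inj₁ r≡0
... | no r≢0 = inj₂ (begin
  s              ≡⟨ sym (*-identityˡ s) ⟩
  1ℚ * s         ≡⟨ cong (_* s) (sym (*-inverseˡ r)) ⟩
  (1/ r * r) * s ≡⟨ *-assoc (1/ r) r s ⟩
  1/ r * (r * s) ≡⟨ cong (1/ r *_) rs≡0 ⟩
  1/ r * 0ℚ      ≡⟨ *-zeroʳ (1/ r) ⟩
  0ℚ             ∎)
  where instance _ = ≢-nonZero r≢0

s⊙w≡0²⇒s≡0⊎w≡0² : ∀ {s w} → s ⊙ w ≡ 0² → s ≡ 0ℚ ⊎ w ≡ 0²
s⊙w≡0²⇒s≡0⊎w≡0² {s} {a , b} eq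
  with r*s≡0⇒r≡0⊎s≡0 (cong proj₁ eq) | r*s≡0⇒r≡0⊎s≡0 (cong proj₂ eq)
... | inj₁ s≡0 | _         = inj₁ s≡0
... | inj₂ _   | inj₁ s≡0  = inj₁ s≡0
... | inj₂ a≡0 | inj₂ b≡0  = inj₂ (cong₂ _,_ a≡0 b≡0)

perp≡0²⇒≡0² : ∀ {w} → perp w ≡ 0² → w ≡ 0²
perp≡0²⇒≡0² {a , b} eq = cong₂ _,_ (cong proj₂ eq) (neg-injective (cong proj₁ eq))

−²≡0²⇒≡ : ∀ {z c} → z −² c ≡ 0² → z ≡ c
−²≡0²⇒≡ {z₁ , z₂} {c₁ , c₂} eq =
  cong₂ _,_ (x∙y⁻¹≈ε⇒x≈y z₁ c₁ (cong proj₁ eq)) (x∙y⁻¹≈ε⇒x≈y z₂ c₂ (cong proj₂ eq))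

−²-self : ∀ c → c −² c ≡ 0²
−²-self (c₁ , c₂) = cong₂ _,_ (+-inverseʳ c₁) (+-inverseʳ c₂)

·-zeroʳ : ∀ w → w · 0² ≡ 0ℚ
·-zeroʳ (a , b) = cong₂ _+_ (*-zeroʳ a) (*-zeroʳ b)

⊙-zeroˡ : ∀ w → 0ℚ ⊙ w ≡ 0²
⊙-zeroˡ (a , b) = cong₂ _,_ (*-zeroˡ a) (*-zeroˡ b)

spike : ∀ {n} → Fin n → ℚ² → Fin n → ℚ²
spike w₀ x = updateAt (λ _ → 0²) w₀ (λ _ → x)

spike-at : ∀ {n} (w₀ : Fin n) x → spike w₀ x w₀ ≡ x
spike-at w₀ x = updateAt-updates w₀ (λ _ → 0²)

spike-off : ∀ {n} {w₀ w : Fin n} {x} → w ≢ w₀ → spike w₀ x w ≡ 0²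
spike-off {w₀ = w₀} {w} w≢w₀ = updateAt-minimal w w₀ (λ _ → 0²) w≢w₀

rotation≡0²⇒s≡0⊎z≡c : ∀ s c z → rotation s c z ≡ 0² → s ≡ 0ℚ ⊎ z ≡ c
rotation≡0²⇒s≡0⊎z≡c _ _ _ eq =
  map₂ (λ d≡0 → −²≡0²⇒≡ (perp≡0²⇒≡0² d≡0)) (s⊙w≡0²⇒s≡0⊎w≡0² eq)

rotation-center : ∀ s c → rotation s c c ≡ 0²
rotation-center s c = begin
  s ⊙ perp (c −² c) ≡⟨ cong (λ d → s ⊙ perp d) (−²-self c) ⟩
  s ⊙ perp 0²       ≡⟨ cong₂ _,_ (*-zeroʳ s) (*-zeroʳ s) ⟩
  0²                ∎

rotation-at-center : ∀ s {c z} → z ≡ c → rotation s c z ≡ 0²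
rotation-at-center s {c} refl = rotation-center s c

motion-center : ∀ s c t → motion s c t c ≡ t
motion-center s c t@(t₁ , t₂) = begin
  rotation s c c +² t ≡⟨ cong (_+² t) (rotation-center s c) ⟩
  0² +² t             ≡⟨ cong₂ _,_ (+-identityˡ t₁) (+-identityˡ t₂) ⟩
  t                   ∎

·e₁≡0⇒·e₂≡0⇒≡0² : ∀ w → w · (1ℚ , 0ℚ) ≡ 0ℚ → w · (0ℚ , 1ℚ) ≡ 0ℚ → w ≡ 0²
·e₁≡0⇒·e₂≡0⇒≡0² (a , b) a≡0 b≡0 = cong₂ _,_
  (trans (sym (trans (cong₂ _+_ (*-identityʳ a) (*-zeroʳ b)) (+-identityʳ a))) a≡0)
  (trans (sym (trans (cong₂ _+_ (*-zeroʳ a) (*-identityʳ b)) (+-identityˡ b))) b≡0)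

elongation-zero : ∀ P Q → elongation P Q 0² 0² ≡ 0ℚ
elongation-zero P Q = cong₂ _+_ (·-zeroʳ (P −² Q)) (·-zeroʳ (Q −² P))

elongation-coincident : ∀ {P Q} x y → P ≡ Q → elongation P Q x y ≡ 0ℚ
elongation-coincident {a₁ , a₂} (x₁ , x₂) (y₁ , y₂) refl = identity a₁ a₂ x₁ x₂ y₁ y₂
  where
  identity : ∀ a₁ a₂ x₁ x₂ y₁ y₂ →
    ((a₁ - a₁) * x₁ + (a₂ - a₂) * x₂) + ((a₁ - a₁) * y₁ + (a₂ - a₂) * y₂) ≡ 0ℚ
  identity = solve-∀ ℚ-ring

rotation-elongation : ∀ s c P Q → elongation P Q (rotation s c P) (rotation s c Q) ≡ 0ℚ
rotation-elongation s (c₁ , c₂) (a₁ , a₂) (b₁ , b₂) = identity s c₁ c₂ a₁ a₂ b₁ b₂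
  where
  identity : ∀ s c₁ c₂ a₁ a₂ b₁ b₂ →
    ((a₁ - b₁) * (s * (- (a₂ - c₂))) + (a₂ - b₂) * (s * (a₁ - c₁))) +
    ((b₁ - a₁) * (s * (- (b₂ - c₂))) + (b₂ - a₂) * (s * (b₁ - c₁))) ≡ 0ℚ
  identity = solve-∀ ℚ-ring

motion-elongation : ∀ s c t P Q → elongation P Q (motion s c t P) (motion s c t Q) ≡ 0ℚ
motion-elongation s (c₁ , c₂) (t₁ , t₂) (a₁ , a₂) (b₁ , b₂) = identity s c₁ c₂ t₁ t₂ a₁ a₂ b₁ b₂
  where
  identity : ∀ s c₁ c₂ t₁ t₂ a₁ a₂ b₁ b₂ →
    ((a₁ - b₁) * (s * (- (a₂ - c₂)) + t₁) + (a₂ - b₂) * (s * (a₁ - c₁) + t₂)) +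
    ((b₁ - a₁) * (s * (- (b₂ - c₂)) + t₁) + (b₂ - a₂) * (s * (b₁ - c₁) + t₂)) ≡ 0ℚ
  identity = solve-∀ ℚ-ring

-- The angular speeds are the coefficients of the linear dependency
-- cross d₂ d₃ ⊙ d₁ + cross d₃ d₁ ⊙ d₂ + cross d₁ d₂ ⊙ d₃ = 0 among the bars
-- d₁ = Q − P, d₂ = R − Q, d₃ = P′ − R of the four-bar linkage P Q R P′.
four-bar-closes : ∀ P Q R P′ →
  motion (cross (P′ −² R) (Q −² P)) Q (rotation (cross (R −² Q) (P′ −² R)) P Q) R
    ≡ rotation (cross (Q −² P) (R −² Q)) P′ R
four-bar-closes (p₁ , p₂) (q₁ , q₂) (r₁ , r₂) (s₁ , s₂) =
  cong₂ _,_ (first p₁ p₂ q₁ q₂ r₁ r₂ s₁ s₂) (second p₁ p₂ q₁ q₂ r₁ r₂ s₁ s₂)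
  where
  first : ∀ p₁ p₂ q₁ q₂ r₁ r₂ s₁ s₂ →
    ((s₁ - r₁) * (q₂ - p₂) - (s₂ - r₂) * (q₁ - p₁)) * (- (r₂ - q₂)) +
    ((r₁ - q₁) * (s₂ - r₂) - (r₂ - q₂) * (s₁ - r₁)) * (- (q₂ - p₂))
      ≡ ((q₁ - p₁) * (r₂ - q₂) - (q₂ - p₂) * (r₁ - q₁)) * (- (r₂ - s₂))
  first = solve-∀ ℚ-ring
  second : ∀ p₁ p₂ q₁ q₂ r₁ r₂ s₁ s₂ →
    ((s₁ - r₁) * (q₂ - p₂) - (s₂ - r₂) * (q₁ - p₁)) * (r₁ - q₁) +
    ((r₁ - q₁) * (s₂ - r₂) - (r₂ - q₂) * (s₁ - r₁)) * (q₁ - p₁)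
      ≡ ((q₁ - p₁) * (r₂ - q₂) - (q₂ - p₂) * (r₁ - q₁)) * (r₁ - s₁)
  second = solve-∀ ℚ-ring

-- When the bars Q − P and R − Q are parallel, a further linear dependency
-- between them is ((R − Q)·ε) ⊙ (Q − P) − ((Q − P)·ε) ⊙ (R − Q) = 0.
parallel-bars-close : ∀ P Q R ε →
  motion (- ((Q −² P) · ε)) Q (rotation ((R −² Q) · ε) P Q) R ≡ cross (Q −² P) (R −² Q) ⊙ ε
parallel-bars-close (p₁ , p₂) (q₁ , q₂) (r₁ , r₂) (e₁ , e₂) =
  cong₂ _,_ (first p₁ p₂ q₁ q₂ r₁ r₂ e₁ e₂) (second p₁ p₂ q₁ q₂ r₁ r₂ e₁ e₂)
  where
  first : ∀ p₁ p₂ q₁ q₂ r₁ r₂ e₁ e₂ →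
    (- ((q₁ - p₁) * e₁ + (q₂ - p₂) * e₂)) * (- (r₂ - q₂)) +
    ((r₁ - q₁) * e₁ + (r₂ - q₂) * e₂) * (- (q₂ - p₂))
      ≡ ((q₁ - p₁) * (r₂ - q₂) - (q₂ - p₂) * (r₁ - q₁)) * e₁
  first = solve-∀ ℚ-ring
  second : ∀ p₁ p₂ q₁ q₂ r₁ r₂ e₁ e₂ →
    (- ((q₁ - p₁) * e₁ + (q₂ - p₂) * e₂)) * (r₁ - q₁) +
    ((r₁ - q₁) * e₁ + (r₂ - q₂) * e₂) * (q₁ - p₁)
      ≡ ((q₁ - p₁) * (r₂ - q₂) - (q₂ - p₂) * (r₁ - q₁)) * e₂
  second = solve-∀ ℚ-ring

module _ {n : ℕ} {G : LoopedGraph n} {a b : Fin n} (T : Unbalanced2Sep G a b) where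

  shared⇒hinge : ∀ {w} → w ∈ V₁ T → w ∈ V₂ T → w ≡ a ⊎ w ≡ b
  shared⇒hinge x y = Equivalence.to (meet T _) (x , y)

  not-shared : ∀ {w} → w ≢ a → w ≢ b → w ∈ V₁ T → w ∉ V₂ T
  not-shared w≢a w≢b x y = [ w≢a , w≢b ] (shared⇒hinge x y)

  hinge₂-shared : b ∈ V₁ T × b ∈ V₂ T
  hinge₂-shared = Equivalence.from (meet T b) (inj₂ refl)

  edge-side : (e : Edge G) →
    (end₁ G e ∈ V₁ T × end₂ G e ∈ V₁ T) ⊎ (end₁ G e ∈ V₂ T × end₂ G e ∈ V₂ T)
  edge-side e with inE₁ T e in eq
  ... | true  = inj₁ (edges₁ T e eq)
  ... | false = inj₂ (edges₂ T e eq)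

swap-hinges : ∀ {n} {G : LoopedGraph n} {a b : Fin n} →
  Unbalanced2Sep G a b → Unbalanced2Sep G b a
swap-hinges T = record
  { V₁ = V₁ T ; V₂ = V₂ T ; inE₁ = inE₁ T ; cover = cover T
  ; edges₁ = edges₁ T ; edges₂ = edges₂ T ; loops₁ = loops₁ T
  ; u≢v = ≢-sym (u≢v T)
  ; meet = λ w → mk⇔ (Sum.swap ∘ Equivalence.to (meet T w))
                     (Equivalence.from (meet T w) ∘ Sum.swap)
  ; unbalanced = let (w , w∈V₂ , w≢a , w≢b) = unbalanced T in w , w∈V₂ , w≢b , w≢a
  }

-- Flexes assembled on the four quadrants

module Quadrants {n : ℕ} {G : LoopedGraph n} (rigid : Rigid G)
  {u v u′ v′ : Fin n} (S : Unbalanced2Sep G u v) (S′ : Unbalanced2Sep G u′ v′)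
  (u≢u′ : u ≢ u′) (u≢v′ : u ≢ v′) (v≢u′ : v ≢ u′) (v≢v′ : v ≢ v′) where

  p : Fin n → ℚ²
  p = proj₁ rigid

  q : Loop G → ℚ²
  q = proj₁ (proj₂ rigid)

  kernel-trivial : (x : Fin n → ℚ²) → InKernel G p q x → ∀ w → x w ≡ 0²
  kernel-trivial = proj₂ (proj₂ rigid)

  hinges-disjoint : ∀ {w} → w ≡ u ⊎ w ≡ v → w ≡ u′ ⊎ w ≡ v′ → ⊥
  hinges-disjoint (inj₁ refl) = [ u≢u′ , u≢v′ ]
  hinges-disjoint (inj₂ refl) = [ v≢u′ , v≢v′ ]

  opposite-disjoint : ∀ {w} → w ∈ V₁ S → w ∈ V₂ S → w ∈ V₁ S′ → w ∈ V₂ S′ → ⊥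
  opposite-disjoint x₁ x₂ y₁ y₂ = hinges-disjoint (shared⇒hinge S x₁ x₂) (shared⇒hinge S′ y₁ y₂)

  data Quadrant : Set where
    Q₁₁ Q₁₂ Q₂₁ Q₂₂ : Quadrant

  InQuadrant : Quadrant → Fin n → Set
  InQuadrant Q₁₁ w = w ∈ V₁ S × w ∈ V₁ S′
  InQuadrant Q₁₂ w = w ∈ V₁ S × w ∈ V₂ S′
  InQuadrant Q₂₁ w = w ∈ V₂ S × w ∈ V₁ S′
  InQuadrant Q₂₂ w = w ∈ V₂ S × w ∈ V₂ S′

  quadrant-of : ∀ w → ∃ λ k → InQuadrant k w
  quadrant-of w with cover S w | cover S′ w
  ... | inj₁ x | inj₁ y = Q₁₁ , x , y
  ... | inj₁ x | inj₂ y = Q₁₂ , x , y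
  ... | inj₂ x | inj₁ y = Q₂₁ , x , y
  ... | inj₂ x | inj₂ y = Q₂₂ , x , y

  edge-quadrant : ∀ e → ∃ λ k → InQuadrant k (end₁ G e) × InQuadrant k (end₂ G e)
  edge-quadrant e with edge-side S e | edge-side S′ e
  ... | inj₁ (x₁ , x₂) | inj₁ (y₁ , y₂) = Q₁₁ , (x₁ , y₁) , (x₂ , y₂)
  ... | inj₁ (x₁ , x₂) | inj₂ (y₁ , y₂) = Q₁₂ , (x₁ , y₁) , (x₂ , y₂)
  ... | inj₂ (x₁ , x₂) | inj₁ (y₁ , y₂) = Q₂₁ , (x₁ , y₁) , (x₂ , y₂)
  ... | inj₂ (x₁ , x₂) | inj₂ (y₁ , y₂) = Q₂₂ , (x₁ , y₁) , (x₂ , y₂)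

  EdgeRow : (Fin n → ℚ²) → Edge G → Set
  EdgeRow x e = elongation (p (end₁ G e)) (p (end₂ G e)) (x (end₁ G e)) (x (end₂ G e)) ≡ 0ℚ

  RowsWithin : Quadrant → (Fin n → ℚ²) → Set
  RowsWithin k x = ∀ e → InQuadrant k (end₁ G e) → InQuadrant k (end₂ G e) → EdgeRow x e

  Pieces : Set
  Pieces = Quadrant → Fin n → ℚ²

  Agree : Pieces → Set
  Agree f = ∀ j k {w} → InQuadrant j w → InQuadrant k w → f j w ≡ f k w

  -- Q₁₁ contains every loop, so keeping it fixed satisfies all loop rows.
  record IsFlex (f : Pieces) : Set where
    field
      agree  : Agree f
      rows   : ∀ k → RowsWithin k (f k)
      pinned : ∀ w → f Q₁₁ w ≡ 0²

  glue : Pieces → Fin n → ℚ²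
  glue f w = f (proj₁ (quadrant-of w)) w

  module _ {f : Pieces} (φ : IsFlex f) where
    open IsFlex φ

    glue-at : ∀ k {w} → InQuadrant k w → glue f w ≡ f k w
    glue-at k {w} w∈k = agree (proj₁ (quadrant-of w)) k (proj₂ (quadrant-of w)) w∈k

    glue-in-kernel : InKernel G p q (glue f)
    glue-in-kernel = edge-rows , loop-rows
      where
      edge-rows : ∀ e → EdgeRow (glue f) e
      edge-rows e with edge-quadrant e
      ... | k , x₁ , x₂ rewrite glue-at k x₁ | glue-at k x₂ = rows k e x₁ x₂
      loop-rows : ∀ l → q l · glue f (loopAt G l) ≡ 0ℚ
      loop-rows l = begin
        q l · glue f (loopAt G l) ≡⟨ cong (q l ·_) (glue-at Q₁₁ (loops₁ S l , loops₁ S′ l)) ⟩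
        q l · f Q₁₁ (loopAt G l)  ≡⟨ cong (q l ·_) (pinned (loopAt G l)) ⟩
        q l · 0²                  ≡⟨ ·-zeroʳ (q l) ⟩
        0ℚ                        ∎

    flex-vanishes : ∀ k {w} → InQuadrant k w → f k w ≡ 0²
    flex-vanishes k {w} w∈k =
      trans (sym (glue-at k w∈k)) (kernel-trivial (glue f) glue-in-kernel w)

  agree-adjacent : ∀ f →
    (∀ {w} → InQuadrant Q₁₁ w → InQuadrant Q₂₁ w → f Q₁₁ w ≡ f Q₂₁ w) →
    (∀ {w} → InQuadrant Q₂₁ w → InQuadrant Q₂₂ w → f Q₂₁ w ≡ f Q₂₂ w) →
    (∀ {w} → InQuadrant Q₂₂ w → InQuadrant Q₁₂ w → f Q₂₂ w ≡ f Q₁₂ w) →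
    (∀ {w} → InQuadrant Q₁₂ w → InQuadrant Q₁₁ w → f Q₁₂ w ≡ f Q₁₁ w) →
    Agree f
  agree-adjacent f h₁ h₂ h₃ h₄ = agree
    where
    agree : Agree f
    agree Q₁₁ Q₁₁ _ _ = refl
    agree Q₁₂ Q₁₂ _ _ = refl
    agree Q₂₁ Q₂₁ _ _ = refl
    agree Q₂₂ Q₂₂ _ _ = refl
    agree Q₁₁ Q₂₁ x y = h₁ x y
    agree Q₂₁ Q₁₁ x y = sym (h₁ y x)
    agree Q₂₁ Q₂₂ x y = h₂ x y
    agree Q₂₂ Q₂₁ x y = sym (h₂ y x)
    agree Q₂₂ Q₁₂ x y = h₃ x y
    agree Q₁₂ Q₂₂ x y = sym (h₃ y x)
    agree Q₁₂ Q₁₁ x y = h₄ x y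
    agree Q₁₁ Q₁₂ x y = sym (h₄ y x)
    agree Q₁₁ Q₂₂ (x₁ , y₁) (x₂ , y₂) = ⊥-elim (opposite-disjoint x₁ x₂ y₁ y₂)
    agree Q₂₂ Q₁₁ (x₂ , y₂) (x₁ , y₁) = ⊥-elim (opposite-disjoint x₁ x₂ y₁ y₂)
    agree Q₁₂ Q₂₁ (x₁ , y₂) (x₂ , y₁) = ⊥-elim (opposite-disjoint x₁ x₂ y₁ y₂)
    agree Q₂₁ Q₁₂ (x₂ , y₁) (x₁ , y₂) = ⊥-elim (opposite-disjoint x₁ x₂ y₁ y₂)

  zero-rows : ∀ k → RowsWithin k (λ _ → 0²)
  zero-rows _ e _ _ = elongation-zero (p (end₁ G e)) (p (end₂ G e))

  rotation-rows : ∀ k s c → RowsWithin k (λ w → rotation s c (p w))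
  rotation-rows _ s c e _ _ = rotation-elongation s c (p (end₁ G e)) (p (end₂ G e))

  motion-rows : ∀ k s c t → RowsWithin k (λ w → motion s c t (p w))
  motion-rows _ s c t e _ _ = motion-elongation s c t (p (end₁ G e)) (p (end₂ G e))

  Collapsed : Quadrant → Set
  Collapsed k = ∃ λ c → ∀ {w} → InQuadrant k w → p w ≡ c

  collapsed-rows : ∀ k → Collapsed k → ∀ x → RowsWithin k x
  collapsed-rows _ (c , at-c) x e x₁ x₂ =
    elongation-coincident _ _ (trans (at-c x₁) (sym (at-c x₂)))

  rotation-collapses : ∀ {f} → IsFlex f → ∀ k c →
    (∀ w → f k w ≡ rotation 1ℚ c (p w)) → Collapsed k
  rotation-collapses φ k c piece = c , λ {w} w∈k →
    [ (λ ()) , id ]′ (rotation≡0²⇒s≡0⊎z≡c 1ℚ c (p w)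
      (trans (sym (piece w)) (flex-vanishes φ k w∈k)))

  -- All bars at a vertex in collapsed quadrants have length zero, so it can move alone.
  no-private-vertex : (A : Quadrant → Bool) → A Q₁₁ ≡ false →
    (∀ k → A k ≡ true → Collapsed k) → ∀ w₀ → ¬ (∀ k → InQuadrant k w₀ → A k ≡ true)
  no-private-vertex A Q₁₁-fixed collapsed w₀ only-active =
    let (k , w₀∈k) = quadrant-of w₀ in
    e₁≢0² (trans (sym (piece-at k w₀∈k)) (flex-vanishes φ k w₀∈k))
    where
    e₁≢0² : (1ℚ , 0ℚ) ≢ 0²
    e₁≢0² ()
    f : Pieces
    f k w = if A k then spike w₀ (1ℚ , 0ℚ) w else 0²
    piece-at : ∀ k → InQuadrant k w₀ → f k w₀ ≡ (1ℚ , 0ℚ)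
    piece-at k x rewrite only-active k x = spike-at w₀ (1ℚ , 0ℚ)
    piece-off : ∀ k {w} → w ≢ w₀ → f k w ≡ 0²
    piece-off k w≢w₀ with A k
    ... | true  = spike-off w≢w₀
    ... | false = refl
    agree : Agree f
    agree j k {w} x y with w ≟ᶠ w₀
    ... | yes refl  = trans (piece-at j x) (sym (piece-at k y))
    ... | no w≢w₀   = trans (piece-off j w≢w₀) (sym (piece-off k w≢w₀))
    rows : ∀ k → RowsWithin k (f k)
    rows k with A k in active
    ... | true  = collapsed-rows k (collapsed k active) (spike w₀ (1ℚ , 0ℚ))
    ... | false = zero-rows k
    pinned : ∀ w → f Q₁₁ w ≡ 0²
    pinned w rewrite Q₁₁-fixed = refl
    φ : IsFlex f
    φ = record { agree = agree ; rows = rows ; pinned = pinned }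

  module Crossing (u′∈V₁S : u′ ∈ V₁ S) (v′∈V₂S : v′ ∈ V₂ S) where

    u′∉V₂S : u′ ∉ V₂ S
    u′∉V₂S = not-shared S (≢-sym u≢u′) (≢-sym v≢u′) u′∈V₁S

    v′∉V₁S : v′ ∉ V₁ S
    v′∉V₁S x = not-shared S (≢-sym u≢v′) (≢-sym v≢v′) x v′∈V₂S

    at-v′ : ∀ {w} → InQuadrant Q₂₁ w → InQuadrant Q₂₂ w → w ≡ v′
    at-v′ (x , y₁) (_ , y₂) with shared⇒hinge S′ y₁ y₂
    ... | inj₁ refl = ⊥-elim (u′∉V₂S x)
    ... | inj₂ w≡v′ = w≡v′

    at-u′ : ∀ {w} → InQuadrant Q₁₂ w → InQuadrant Q₁₁ w → w ≡ u′
    at-u′ (x , y₂) (_ , y₁) with shared⇒hinge S′ y₁ y₂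
    ... | inj₁ w≡u′ = w≡u′
    ... | inj₂ refl = ⊥-elim (v′∉V₁S x)

    side₂-not-collapsed : Collapsed Q₂₁ → Collapsed Q₂₂ → ⊥
    side₂-not-collapsed c₂₁ c₂₂ = no-private-vertex side₂ refl collapsed v′ v′-private
      where
      side₂ : Quadrant → Bool
      side₂ Q₂₁ = true
      side₂ Q₂₂ = true
      side₂ _   = false
      collapsed : ∀ k → side₂ k ≡ true → Collapsed k
      collapsed Q₂₁ _ = c₂₁
      collapsed Q₂₂ _ = c₂₂
      collapsed Q₁₁ ()
      collapsed Q₁₂ ()
      v′-private : ∀ k → InQuadrant k v′ → side₂ k ≡ true
      v′-private Q₁₁ (x , _) = ⊥-elim (v′∉V₁S x)
      v′-private Q₁₂ (x , _) = ⊥-elim (v′∉V₁S x)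
      v′-private Q₂₁ _ = refl
      v′-private Q₂₂ _ = refl

    -- Q₂₂ and Q₁₂ hang at v′ and u′ only; each collapses, and the unbalancing
    -- vertex of S′ then moves alone.
    hinges-on-side₁-impossible : u ∈ V₁ S′ → v ∈ V₁ S′ → ⊥
    hinges-on-side₁-impossible u∈V₁S′ v∈V₁S′ =
      no-private-vertex side₂′ refl collapsed w₀ w₀-private
      where
      hinge∉V₂S′ : ∀ {w} → w ≡ u ⊎ w ≡ v → w ∉ V₂ S′
      hinge∉V₂S′ (inj₁ refl) = not-shared S′ u≢u′ u≢v′ u∈V₁S′
      hinge∉V₂S′ (inj₂ refl) = not-shared S′ v≢u′ v≢v′ v∈V₁S′
      f : Pieces
      f Q₁₁ _ = 0²
      f Q₂₁ _ = 0²
      f Q₂₂ w = rotation 1ℚ (p v′) (p w)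
      f Q₁₂ w = rotation 1ℚ (p u′) (p w)
      φ : IsFlex f
      φ = record
        { agree = agree-adjacent f (λ _ _ → refl)
            (λ x y → sym (rotation-at-center 1ℚ (cong p (at-v′ x y))))
            (λ (x₂ , y) (x₁ , _) → ⊥-elim (hinge∉V₂S′ (shared⇒hinge S x₁ x₂) y))
            (λ x y → rotation-at-center 1ℚ (cong p (at-u′ x y)))
        ; rows = λ { Q₁₁ → zero-rows Q₁₁ ; Q₂₁ → zero-rows Q₂₁
                   ; Q₂₂ → rotation-rows Q₂₂ 1ℚ (p v′) ; Q₁₂ → rotation-rows Q₁₂ 1ℚ (p u′) }
        ; pinned = λ _ → refl
        }
      side₂′ : Quadrant → Bool
      side₂′ Q₁₂ = true
      side₂′ Q₂₂ = true
      side₂′ _   = false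
      collapsed : ∀ k → side₂′ k ≡ true → Collapsed k
      collapsed Q₁₂ _ = rotation-collapses φ Q₁₂ (p u′) (λ _ → refl)
      collapsed Q₂₂ _ = rotation-collapses φ Q₂₂ (p v′) (λ _ → refl)
      collapsed Q₁₁ ()
      collapsed Q₂₁ ()
      w₀ : Fin n
      w₀ = proj₁ (unbalanced S′)
      w₀∉V₁S′ : w₀ ∉ V₁ S′
      w₀∉V₁S′ x =
        let (_ , y , w₀≢u′ , w₀≢v′) = unbalanced S′ in not-shared S′ w₀≢u′ w₀≢v′ x y
      w₀-private : ∀ k → InQuadrant k w₀ → side₂′ k ≡ true
      w₀-private Q₁₁ (_ , y) = ⊥-elim (w₀∉V₁S′ y)
      w₀-private Q₂₁ (_ , y) = ⊥-elim (w₀∉V₁S′ y)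
      w₀-private Q₁₂ _ = refl
      w₀-private Q₂₂ _ = refl

    -- Q₂₁ ∪ Q₂₂ ∪ Q₁₂ hangs from Q₁₁ at u′ only, so it turns about p u′.
    hinges-on-side₂-impossible : u ∈ V₂ S′ → v ∈ V₂ S′ → ⊥
    hinges-on-side₂-impossible u∈V₂S′ v∈V₂S′ =
      side₂-not-collapsed (rotation-collapses φ Q₂₁ (p u′) (λ _ → refl))
                          (rotation-collapses φ Q₂₂ (p u′) (λ _ → refl))
      where
      hinge∉V₁S′ : ∀ {w} → w ≡ u ⊎ w ≡ v → w ∉ V₁ S′
      hinge∉V₁S′ (inj₁ refl) x = not-shared S′ u≢u′ u≢v′ x u∈V₂S′
      hinge∉V₁S′ (inj₂ refl) x = not-shared S′ v≢u′ v≢v′ x v∈V₂S′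
      f : Pieces
      f Q₁₁ _ = 0²
      f _   w = rotation 1ℚ (p u′) (p w)
      φ : IsFlex f
      φ = record
        { agree = agree-adjacent f
            (λ (x₁ , y) (x₂ , _) → ⊥-elim (hinge∉V₁S′ (shared⇒hinge S x₁ x₂) y))
            (λ _ _ → refl) (λ _ _ → refl)
            (λ x y → rotation-at-center 1ℚ (cong p (at-u′ x y)))
        ; rows = λ { Q₁₁ → zero-rows Q₁₁ ; Q₁₂ → rotation-rows Q₁₂ 1ℚ (p u′)
                   ; Q₂₁ → rotation-rows Q₂₁ 1ℚ (p u′) ; Q₂₂ → rotation-rows Q₂₂ 1ℚ (p u′) }
        ; pinned = λ _ → refl
        }

    module FourBar (u∈V₁S′ : u ∈ V₁ S′) (v∈V₂S′ : v ∈ V₂ S′) where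

      at-u : ∀ {w} → InQuadrant Q₁₁ w → InQuadrant Q₂₁ w → w ≡ u
      at-u (x₁ , y) (x₂ , _) with shared⇒hinge S x₁ x₂
      ... | inj₁ w≡u = w≡u
      ... | inj₂ refl = ⊥-elim (not-shared S′ v≢u′ v≢v′ y v∈V₂S′)

      at-v : ∀ {w} → InQuadrant Q₂₂ w → InQuadrant Q₁₂ w → w ≡ v
      at-v (x₂ , y) (x₁ , _) with shared⇒hinge S x₁ x₂
      ... | inj₁ refl = ⊥-elim (not-shared S′ u≢u′ u≢v′ u∈V₁S′ y)
      ... | inj₂ w≡v = w≡v

      agree-at-hinges : ∀ f → f Q₁₁ u ≡ f Q₂₁ u → f Q₂₁ v′ ≡ f Q₂₂ v′ →
        f Q₂₂ v ≡ f Q₁₂ v → f Q₁₂ u′ ≡ f Q₁₁ u′ → Agree f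
      agree-at-hinges f at₁ at₂ at₃ at₄ = agree-adjacent f
        (λ x y → subst (λ w → f Q₁₁ w ≡ f Q₂₁ w) (sym (at-u x y)) at₁)
        (λ x y → subst (λ w → f Q₂₁ w ≡ f Q₂₂ w) (sym (at-v′ x y)) at₂)
        (λ x y → subst (λ w → f Q₂₂ w ≡ f Q₁₂ w) (sym (at-v x y)) at₃)
        (λ x y → subst (λ w → f Q₁₂ w ≡ f Q₁₁ w) (sym (at-u′ x y)) at₄)

      v′∈Q₂₁ : InQuadrant Q₂₁ v′
      v′∈Q₂₁ = v′∈V₂S , proj₁ (hinge₂-shared S′)

      v′∈Q₂₂ : InQuadrant Q₂₂ v′
      v′∈Q₂₂ = v′∈V₂S , proj₂ (hinge₂-shared S′)

      v∈Q₁₂ : InQuadrant Q₁₂ v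
      v∈Q₁₂ = proj₁ (hinge₂-shared S) , v∈V₂S′

      -- Otherwise Q₂₁ ∪ Q₂₂ turns about p u.
      pu≢pv : p u ≢ p v
      pu≢pv pu≡pv = side₂-not-collapsed (rotation-collapses φ Q₂₁ (p u) (λ _ → refl))
                                        (rotation-collapses φ Q₂₂ (p u) (λ _ → refl))
        where
        f : Pieces
        f Q₂₁ w = rotation 1ℚ (p u) (p w)
        f Q₂₂ w = rotation 1ℚ (p u) (p w)
        f _   _ = 0²
        φ : IsFlex f
        φ = record
          { agree = agree-at-hinges f (sym (rotation-center 1ℚ (p u))) refl
                                      (rotation-at-center 1ℚ (sym pu≡pv)) refl
          ; rows = λ { Q₂₁ → rotation-rows Q₂₁ 1ℚ (p u) ; Q₂₂ → rotation-rows Q₂₂ 1ℚ (p u)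
                     ; Q₁₁ → zero-rows Q₁₁ ; Q₁₂ → zero-rows Q₁₂ }
          ; pinned = λ _ → refl
          }

      -- Then Q₂₁ turns about p u, so it collapses and may be moved freely at v′
      -- while Q₂₂ ∪ Q₁₂ turns about p u′.
      pv′≡pu⇒pv′≡pu′ : p v′ ≡ p u → p v′ ≡ p u′
      pv′≡pu⇒pv′≡pu′ pv′≡pu =
        [ (λ ()) , id ]′ (rotation≡0²⇒s≡0⊎z≡c 1ℚ (p u′) (p v′)
          (trans (sym (spike-at v′ (rotation 1ℚ (p u′) (p v′)))) (flex-vanishes ψ Q₂₁ v′∈Q₂₁)))
        where
        f : Pieces
        f Q₂₁ w = rotation 1ℚ (p u) (p w)
        f _   _ = 0²
        φ : IsFlex f
        φ = record
          { agree = agree-at-hinges f (sym (rotation-center 1ℚ (p u)))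
                                      (rotation-at-center 1ℚ pv′≡pu) refl refl
          ; rows = λ { Q₂₁ → rotation-rows Q₂₁ 1ℚ (p u)
                     ; Q₁₁ → zero-rows Q₁₁ ; Q₂₂ → zero-rows Q₂₂ ; Q₁₂ → zero-rows Q₁₂ }
          ; pinned = λ _ → refl
          }
        Q₂₁-collapsed : Collapsed Q₂₁
        Q₂₁-collapsed = rotation-collapses φ Q₂₁ (p u) (λ _ → refl)
        g : Pieces
        g Q₁₁ _ = 0²
        g Q₂₁ w = spike v′ (rotation 1ℚ (p u′) (p v′)) w
        g Q₂₂ w = rotation 1ℚ (p u′) (p w)
        g Q₁₂ w = rotation 1ℚ (p u′) (p w)
        ψ : IsFlex g
        ψ = record
          { agree = agree-at-hinges g (sym (spike-off u≢v′))
                                      (spike-at v′ (rotation 1ℚ (p u′) (p v′)))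
                                      refl (rotation-center 1ℚ (p u′))
          ; rows = λ { Q₁₁ → zero-rows Q₁₁
                     ; Q₂₁ → collapsed-rows Q₂₁ Q₂₁-collapsed (g Q₂₁)
                     ; Q₂₂ → rotation-rows Q₂₂ 1ℚ (p u′) ; Q₁₂ → rotation-rows Q₁₂ 1ℚ (p u′) }
          ; pinned = λ _ → refl
          }

      bars-parallel : p v ≢ p u′ → cross (p v′ −² p u) (p v −² p v′) ≡ 0ℚ
      bars-parallel pv≢pu′ =
        [ id , ⊥-elim ∘ pv≢pu′ ]′
          (rotation≡0²⇒s≡0⊎z≡c c (p u′) (p v) (flex-vanishes φ Q₁₂ v∈Q₁₂))
        where
        a b c : ℚ
        a = cross (p v −² p v′) (p u′ −² p v)
        b = cross (p u′ −² p v) (p v′ −² p u)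
        c = cross (p v′ −² p u) (p v −² p v′)
        f : Pieces
        f Q₁₁ _ = 0²
        f Q₂₁ w = rotation a (p u) (p w)
        f Q₂₂ w = motion b (p v′) (rotation a (p u) (p v′)) (p w)
        f Q₁₂ w = rotation c (p u′) (p w)
        φ : IsFlex f
        φ = record
          { agree = agree-at-hinges f (sym (rotation-center a (p u)))
                                      (sym (motion-center b (p v′) (rotation a (p u) (p v′))))
                                      (four-bar-closes (p u) (p v′) (p v) (p u′))
                                      (rotation-center c (p u′))
          ; rows = λ { Q₁₁ → zero-rows Q₁₁
                     ; Q₂₁ → rotation-rows Q₂₁ a (p u)
                     ; Q₂₂ → motion-rows Q₂₂ b (p v′) (rotation a (p u) (p v′))
                     ; Q₁₂ → rotation-rows Q₁₂ c (p u′) }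
          ; pinned = λ _ → refl
          }

      parallel⇒pv≡pv′ : p v′ ≢ p u → cross (p v′ −² p u) (p v −² p v′) ≡ 0ℚ → p v ≡ p v′
      parallel⇒pv≡pv′ pv′≢pu parallel =
        −²≡0²⇒≡ (·e₁≡0⇒·e₂≡0⇒≡0² (p v −² p v′) (speed≡0 (1ℚ , 0ℚ)) (speed≡0 (0ℚ , 1ℚ)))
        where
        speed≡0 : ∀ ε → (p v −² p v′) · ε ≡ 0ℚ
        speed≡0 ε = [ id , ⊥-elim ∘ pv′≢pu ]′
          (rotation≡0²⇒s≡0⊎z≡c α (p u) (p v′) (flex-vanishes φ Q₂₁ v′∈Q₂₁))
          where
          α β : ℚ
          α = (p v −² p v′) · ε
          β = - ((p v′ −² p u) · ε)
          f : Pieces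
          f Q₂₁ w = rotation α (p u) (p w)
          f Q₂₂ w = motion β (p v′) (rotation α (p u) (p v′)) (p w)
          f _   _ = 0²
          φ : IsFlex f
          φ = record
            { agree = agree-at-hinges f (sym (rotation-center α (p u)))
                (sym (motion-center β (p v′) (rotation α (p u) (p v′))))
                (begin
                  motion β (p v′) (rotation α (p u) (p v′)) (p v)
                    ≡⟨ parallel-bars-close (p u) (p v′) (p v) ε ⟩
                  cross (p v′ −² p u) (p v −² p v′) ⊙ ε
                    ≡⟨ cong (_⊙ ε) parallel ⟩
                  0ℚ ⊙ ε
                    ≡⟨ ⊙-zeroˡ ε ⟩
                  0² ∎)
                refl
            ; rows = λ { Q₂₁ → rotation-rows Q₂₁ α (p u)
                       ; Q₂₂ → motion-rows Q₂₂ β (p v′) (rotation α (p u) (p v′))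
                       ; Q₁₁ → zero-rows Q₁₁ ; Q₁₂ → zero-rows Q₁₂ }
            ; pinned = λ _ → refl
            }

      -- Then Q₂₂ turns about p v′, so it collapses and may be moved freely at v′
      -- while Q₂₁ turns about p u.
      pv≡pv′⇒pv′≡pu : p v ≡ p v′ → p v′ ≡ p u
      pv≡pv′⇒pv′≡pu pv≡pv′ =
        [ (λ ()) , id ]′ (rotation≡0²⇒s≡0⊎z≡c 1ℚ (p u) (p v′)
          (trans (sym (spike-at v′ (rotation 1ℚ (p u) (p v′)))) (flex-vanishes ψ Q₂₂ v′∈Q₂₂)))
        where
        f : Pieces
        f Q₂₂ w = rotation 1ℚ (p v′) (p w)
        f _   _ = 0²
        φ : IsFlex f
        φ = record
          { agree = agree-at-hinges f refl (sym (rotation-center 1ℚ (p v′)))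
                                      (rotation-at-center 1ℚ pv≡pv′) refl
          ; rows = λ { Q₂₂ → rotation-rows Q₂₂ 1ℚ (p v′)
                     ; Q₁₁ → zero-rows Q₁₁ ; Q₂₁ → zero-rows Q₂₁ ; Q₁₂ → zero-rows Q₁₂ }
          ; pinned = λ _ → refl
          }
        Q₂₂-collapsed : Collapsed Q₂₂
        Q₂₂-collapsed = rotation-collapses φ Q₂₂ (p v′) (λ _ → refl)
        g : Pieces
        g Q₂₁ w = rotation 1ℚ (p u) (p w)
        g Q₂₂ w = spike v′ (rotation 1ℚ (p u) (p v′)) w
        g _   _ = 0²
        ψ : IsFlex g
        ψ = record
          { agree = agree-at-hinges g (sym (rotation-center 1ℚ (p u)))
                                      (sym (spike-at v′ (rotation 1ℚ (p u) (p v′))))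
                                      (spike-off v≢v′) refl
          ; rows = λ { Q₂₁ → rotation-rows Q₂₁ 1ℚ (p u)
                     ; Q₂₂ → collapsed-rows Q₂₂ Q₂₂-collapsed (g Q₂₂)
                     ; Q₁₁ → zero-rows Q₁₁ ; Q₁₂ → zero-rows Q₁₂ }
          ; pinned = λ _ → refl
          }

-- Exchanging the two separations maps the configuration to itself, with the
-- roles of (u, v) and (u′, v′) swapped.
four-bar-impossible : ∀ {n} {G : LoopedGraph n} (rigid : Rigid G) {u v u′ v′ : Fin n}
  (S : Unbalanced2Sep G u v) (S′ : Unbalanced2Sep G u′ v′) →
  u ≢ u′ → u ≢ v′ → v ≢ u′ → v ≢ v′ →
  u′ ∈ V₁ S → v′ ∈ V₂ S → u ∈ V₁ S′ → v ∈ V₂ S′ → ⊥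
four-bar-impossible rigid {u} {v} {u′} {v′} S S′ u≢u′ u≢v′ v≢u′ v≢v′
                    u′∈V₁S v′∈V₂S u∈V₁S′ v∈V₂S′ =
  pv′≢pu (pv≡pv′⇒pv′≡pu (parallel⇒pv≡pv′ pv′≢pu (bars-parallel pv≢pu′)))
  where
  open Quadrants rigid S S′ u≢u′ u≢v′ v≢u′ v≢v′ using (p)
  open Quadrants.Crossing.FourBar
    rigid S S′ u≢u′ u≢v′ v≢u′ v≢v′ u′∈V₁S v′∈V₂S u∈V₁S′ v∈V₂S′
  module Dual = Quadrants.Crossing.FourBar rigid S′ S
    (≢-sym u≢u′) (≢-sym v≢u′) (≢-sym u≢v′) (≢-sym v≢v′) u∈V₁S′ v∈V₂S′ u′∈V₁S v′∈V₂S
  pv′≢pu : p v′ ≢ p u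
  pv′≢pu pv′≡pu = Dual.pu≢pv (sym (pv′≡pu⇒pv′≡pu′ pv′≡pu))
  pv≢pu′ : p v ≢ p u′
  pv≢pu′ pv≡pu′ = pu≢pv (sym (Dual.pv′≡pu⇒pv′≡pu′ pv≡pu′))

crossing-impossible : ∀ {n} {G : LoopedGraph n} (rigid : Rigid G) {u v u′ v′ : Fin n}
  (S : Unbalanced2Sep G u v) (S′ : Unbalanced2Sep G u′ v′) →
  u ≢ u′ → u ≢ v′ → v ≢ u′ → v ≢ v′ → u′ ∈ V₁ S → v′ ∈ V₂ S → ⊥
crossing-impossible rigid {u} {v} S S′ u≢u′ u≢v′ v≢u′ v≢v′ u′∈V₁S v′∈V₂S =
  case (cover S′ u , cover S′ v) of λ where
    (inj₁ u∈V₁S′ , inj₁ v∈V₁S′) → hinges-on-side₁-impossible u∈V₁S′ v∈V₁S′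
    (inj₂ u∈V₂S′ , inj₂ v∈V₂S′) → hinges-on-side₂-impossible u∈V₂S′ v∈V₂S′
    (inj₁ u∈V₁S′ , inj₂ v∈V₂S′) →
      four-bar-impossible rigid S S′ u≢u′ u≢v′ v≢u′ v≢v′ u′∈V₁S v′∈V₂S u∈V₁S′ v∈V₂S′
    (inj₂ u∈V₂S′ , inj₁ v∈V₁S′) →
      four-bar-impossible rigid (swap-hinges S) S′ v≢u′ v≢v′ u≢u′ u≢v′
                          u′∈V₁S v′∈V₂S v∈V₁S′ u∈V₂S′
  where open Quadrants.Crossing rigid S S′ u≢u′ u≢v′ v≢u′ v≢v′ u′∈V₁S v′∈V₂S

lemma7p2 : {n : ℕ} (G : LoopedGraph n) → IsLoopedSimple G → Rigid G →
    (u v u′ v′ : Fin n) (S : Unbalanced2Sep G u v) (S′ : Unbalanced2Sep G u′ v′) →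
    u ≢ u′ → u ≢ v′ → v ≢ u′ → v ≢ v′ →
    (u′ ∈ V₁ S × v′ ∈ V₁ S) ⊎ (u′ ∈ V₂ S × v′ ∈ V₂ S)
lemma7p2 G _ rigid u v u′ v′ S S′ u≢u′ u≢v′ v≢u′ v≢v′ with cover S u′ | cover S v′
... | inj₁ u′∈V₁S | inj₁ v′∈V₁S = inj₁ (u′∈V₁S , v′∈V₁S)
... | inj₂ u′∈V₂S | inj₂ v′∈V₂S = inj₂ (u′∈V₂S , v′∈V₂S)
... | inj₁ u′∈V₁S | inj₂ v′∈V₂S =
  ⊥-elim (crossing-impossible rigid S S′ u≢u′ u≢v′ v≢u′ v≢v′ u′∈V₁S v′∈V₂S)
... | inj₂ u′∈V₂S | inj₁ v′∈V₁S =
  ⊥-elim (crossing-impossible rigid S (swap-hinges S′) u≢v′ u≢u′ v≢v′ v≢u′ v′∈V₁S u′∈V₂S)
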